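{- In the Chung-Lu random graph model, let $(i_1,\dots,i_{r+1})$ be a sequence of nodes, and let $X_{(i,j)}$ be the indicator that edge $\{i,j\}$ exists, so that $\prod_{k=1}^{r}X_{(i_k,i_{k+1})}$ is the indicator that the path $(i_1,\dots,i_{r+1})$ exists. Let $\mathbf{N}$ be the list of nodes in the new edge interior of this path, let $\mathbf{R_1}$ be the list of pairs (first node, last node) of the repeating edge blocks whose first node has appeared before in the path, and let $\mathbf{R_2}$ be the list of pairs (first node, last node) of the repeating edge blocks whose first node has not appeared before. If the first and last edges of the path are new edges, then $$\Pr\Big(\prod_{k=1}^{r}X_{(i_{k},i_{k+1})} = 1\Big) = \frac{d_{i_{1}}d_{i_{r+1}}}{S}\prod_{i\in\mathbf{N}}\frac{d_{i}^{2}}{S}\prod_{(j,k)\in \mathbf{R_{1}}}\frac{d_{j}d_{k}}{S}\prod_{(l,m)\in \mathbf{R_{2}}}\frac{d_{l}d_{m}}{S}.$$ Furthermore, if $q_i$ is the number of repeating edge blocks of length $i$, then $|\mathbf{N}| = r - 1 - \sum_{i=1}^{r-2}(i+1)q_{i}$.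
   Context: Chung-Lu random graph model: $n$ nodes with expected degrees $d_1,\dots,d_n$, $S=\sum_i d_i$, $\max_i d_i^2\le S$; each undirected edge $\{i,j\}$ (self-loops allowed) is present independently with probability $d_id_j/S$. For a sequence of nodes (path) $(x_1,\dots,x_{r+1})$ with steps $\{x_i,x_{i+1}\}$: a step is a new edge if the same unordered edge has not appeared at an earlier step, and a repeating edge otherwise. A repeating edge block is a maximal list of consecutive repeating edges; its length is its number of edges, its first (last) node is the start of its first (end of its last) edge. The new edge interior is the list (with multiplicity, by position) of nodes $x_m$, $1<m<r+1$, whose incoming and outgoing steps are both new edges. "Appeared before" means occurs at an earlier position of the path. Products over lists are taken with multiplicity.
   Formalization: The expected degrees $d_1,\dots,d_n$ take values in the rationals, so $S$ and the edge probabilities are rational as well. -}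

module Defs where

open import Data.Bool using (Bool; true; false; if_then_else_; not; _∧_)
open import Data.Nat as ℕ using (ℕ; zero; suc; _≤ᵇ_)
open import Data.Fin using (Fin; toℕ)
open import Data.Fin.Properties using () renaming (_≟_ to _≟F_)
open import Data.Bool.ListAction using (any; all)
open import Data.List using (List; []; _∷_; _++_; [_]; map; foldr; concatMap; head; last; length; filter; upTo)
open import Data.List.Base using (allFin)
open import Data.Vec using (Vec; toList)
open import Data.Maybe using (Maybe; just)
open import Data.Product using (_×_; _,_; proj₁; proj₂)
open import Data.Product.Properties using (≡-dec)
open import Relation.Nullary.Decidable using (⌊_⌋)
open import Relation.Binary.PropositionalEquality using (_≡_)
open import Data.Rational using (ℚ; 0ℚ; 1ℚ; _+_; _*_; _-_; 1/_; NonZero)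

sumℚ : List ℚ → ℚ
sumℚ = foldr _+_ 0ℚ

prodℚ : List ℚ → ℚ
prodℚ = foldr _*_ 1ℚ

sumℕ : List ℕ → ℕ
sumℕ = foldr ℕ._+_ 0

-- Undirected edges (self-loops allowed) on nodes Fin n,
-- represented canonically as (min , max).

Edge : ℕ → Set
Edge n = Fin n × Fin n

edge : ∀ {n} → Fin n → Fin n → Edge n
edge i j = if toℕ i ≤ᵇ toℕ j then (i , j) else (j , i)

_≟E_ : ∀ {n} (e e' : Edge n) → _
_≟E_ = ≡-dec _≟F_ _≟F_

_==E_ : ∀ {n} → Edge n → Edge n → Bool
e ==E e' = ⌊ e ≟E e' ⌋

_==N_ : ∀ {n} → Fin n → Fin n → Bool
i ==N j = ⌊ i ≟F j ⌋

allEdges : (n : ℕ) → List (Edge n)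
allEdges n = concatMap (λ i → concatMap (λ j →
  if toℕ i ≤ᵇ toℕ j then [ (i , j) ] else []) (allFin n)) (allFin n)

-- The Chung-Lu model as an explicit finite product probability space.
-- A graph is a 0/1 assignment to the edges; each edge e is present
-- independently with probability p e.

Graph : ℕ → Set
Graph n = Edge n → Bool

set : ∀ {n} → Edge n → Bool → Graph n → Graph n
set e b g e' = if e' ==E e then b else g e'

expect : ∀ {n} → (Edge n → ℚ) → List (Edge n) → (Graph n → ℚ) → ℚ
expect p [] f = f (λ _ → false)
expect p (e ∷ es) f =
  p e * expect p es (λ g → f (set e true g))
  + (1ℚ - p e) * expect p es (λ g → f (set e false g))

Pr : ∀ {n} → (Edge n → ℚ) → (Graph n → Bool) → ℚ
Pr {n} p ev = expect p (allEdges n) (λ g → if ev g then 1ℚ else 0ℚ)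

S : ∀ {n} → (Fin n → ℚ) → ℚ
S {n} d = sumℚ (map d (allFin n))

clProb : ∀ {n} (d : Fin n → ℚ) .{{_ : NonZero (S d)}} → Edge n → ℚ
clProb d (i , j) = (d i * d j) * (1/ S d)

steps : ∀ {n} → List (Fin n) → List (Edge n)
steps (x ∷ y ∷ rest) = edge x y ∷ steps (y ∷ rest)
steps _ = []

PathExists : ∀ {n} → List (Fin n) → Graph n → Bool
PathExists xs g = all g (steps xs)

-- annotated step: start node, end node, whether it is a new edge,
-- and the list of nodes at the earlier positions of the path
record Step (n : ℕ) : Set where
  constructor step
  field
    src  : Fin n
    tgt  : Fin n
    new  : Bool
    prev : List (Fin n)
open Step public

annGo : ∀ {n} → List (Fin n) → List (Edge n) → List (Fin n) → List (Step n)
annGo ps es (x ∷ y ∷ rest) =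
  step x y (not (any (λ e → edge x y ==E e) es)) ps
  ∷ annGo (x ∷ ps) (edge x y ∷ es) (y ∷ rest)
annGo _ _ _ = []

ann : ∀ {n} → List (Fin n) → List (Step n)
ann = annGo [] []

FirstNew : ∀ {n} → List (Fin n) → Set
FirstNew xs = Data.Maybe.map new (head (ann xs)) ≡ just true

LastNew : ∀ {n} → List (Fin n) → Set
LastNew xs = Data.Maybe.map new (last (ann xs)) ≡ just true

-- new edge interior: nodes x_m (1 < m < r+1) whose incoming and outgoing
-- steps are both new edges, in order of position (with multiplicity)
interiorGo : ∀ {n} → List (Step n) → List (Fin n)
interiorGo (a ∷ b ∷ rest) =
  (if new a ∧ new b then [ tgt a ] else []) ++ interiorGo (b ∷ rest)
interiorGo _ = []

newInterior : ∀ {n} → List (Fin n) → List (Fin n)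
newInterior xs = interiorGo (ann xs)

-- repeating edge blocks (maximal runs of consecutive repeating edges)
record Block (n : ℕ) : Set where
  constructor block
  field
    first     : Fin n
    lst       : Fin n
    len       : ℕ       -- number of edges
    seenFirst : Bool    -- first node appeared at an earlier position
open Block public

startBlock : ∀ {n} → Step n → Block n
startBlock s = block (src s) (tgt s) 1 (any (λ y → src s ==N y) (prev s))

extendBlock : ∀ {n} → Block n → Step n → Block n
extendBlock b s = block (first b) (tgt s) (suc (len b)) (seenFirst b)

mutual
  blocksGo : ∀ {n} → List (Step n) → List (Block n)
  blocksGo [] = []
  blocksGo (s ∷ ss) = if new s then blocksGo ss else runGo (startBlock s) ss

  runGo : ∀ {n} → Block n → List (Step n) → List (Block n)
  runGo b [] = [ b ]
  runGo b (s ∷ ss) = if new s then b ∷ blocksGo ss else runGo (extendBlock b s) ss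

blocks : ∀ {n} → List (Fin n) → List (Block n)
blocks xs = blocksGo (ann xs)

R₁ : ∀ {n} → List (Fin n) → List (Fin n × Fin n)
R₁ xs = map (λ b → (first b , lst b)) (filter (λ b → seenFirst b ≡? true) (blocks xs))
  where open import Data.Bool.Properties using () renaming (_≟_ to _≡?_)

R₂ : ∀ {n} → List (Fin n) → List (Fin n × Fin n)
R₂ xs = map (λ b → (first b , lst b)) (filter (λ b → seenFirst b ≡? false) (blocks xs))
  where open import Data.Bool.Properties using () renaming (_≟_ to _≡?_)

q : ∀ {n} → List (Fin n) → ℕ → ℕ
q xs i = length (filter (λ b → len b ℕ.≟ i) (blocks xs))

blockSum : ∀ {n} → List (Fin n) → ℕ → ℕ
blockSum xs r = sumℕ (map (λ i → suc i ℕ.* q xs i) (map suc (upTo (r ℕ.∸ 2))))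

clFormula : ∀ {n} (d : Fin n → ℚ) .{{_ : NonZero (S d)}} →
            Fin n → Fin n → List (Fin n) → ℚ
clFormula d x₁ xₗ xs =
  ((d x₁ * d xₗ) * (1/ S d))
  * prodℚ (map (λ i → (d i * d i) * (1/ S d)) (newInterior xs))
  * prodℚ (map (λ jk → (d (proj₁ jk) * d (proj₂ jk)) * (1/ S d)) (R₁ xs))
  * prodℚ (map (λ lm → (d (proj₁ lm) * d (proj₂ lm)) * (1/ S d)) (R₂ xs))

{-# OPTIONS --safe #-}
module Submission where

-- Under the product measure, the probability that every edge of a list is present is the
-- product of the edge probabilities over its distinct elements, which for the steps of a
-- path are exactly the new steps.  A new step {x, y} contributes d_x d_y / S.  Cutting the
-- path at its repeating edge blocks leaves runs of consecutive new steps: a node inside a run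
-- receives one factor d from each adjacent step, while the two runs around a block supply
-- d of its first and of its last node.  Counting steps along the same decomposition gives
-- r = 1 + |N| + Σ_b (len b + 1), which is the formula for |N| since a block of length i
-- contributes i + 1.

open import Defs
open import Data.Nat using (ℕ; suc; _≤_)
open import Data.Fin using (Fin; zero; fromℕ)
open import Data.Vec using (Vec; toList; head; last)
open import Data.List using (length)
open import Data.Product using (_×_)
open import Data.Integer using (+_) renaming (_-_ to _-ℤ_)
open import Data.Rational using (ℚ; 0ℚ; _≤_; _*_; NonZero)
open import Relation.Binary.PropositionalEquality using (_≡_)

open import Function using (_∘_)
open import Data.Bool using (Bool; true; false; if_then_else_; _∧_; _∨_)
open import Data.Bool.Properties using (∨-zeroʳ; ∧-zeroʳ) renaming (_≟_ to _≟ᵇ_)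
open import Data.Bool.ListAction using (any; all)
open import Data.Nat as ℕ using (z≤n; s≤s; _≤ᵇ_)
import Data.Nat.Properties as ℕ
open import Data.Nat.Solver renaming (module +-*-Solver to ℕ-Solver)
open import Data.Fin using (toℕ)
open import Data.Vec using ([]; _∷_)
open import Data.List using (List; []; _∷_; [_]; map; filter; filterᵇ; upTo)
import Data.List.Base as List
open import Data.List.Properties using (map-cong; map-∘; length-++; filter-++; filter-accept; filter-reject)
open import Data.List.Membership.Propositional using (_∈_; _∉_; lose)
open import Data.List.Membership.Propositional.Properties using (∈-map⁺; ∈-upTo⁺; ∈-concatMap⁺; ∈-allFin)
open import Data.List.Relation.Unary.All as All using (All; []; _∷_)
open import Data.List.Relation.Unary.All.Properties using (All¬⇒¬Any)
open import Data.List.Relation.Unary.Any using (here; there)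
open import Data.List.Relation.Unary.Unique.Propositional using (Unique; _∷_)
import Data.List.Relation.Unary.Unique.Propositional.Properties as Unique
import Data.Maybe as Maybe
open import Data.Maybe using (just)
open import Data.Product using (_,_; proj₁; proj₂)
open import Data.Integer using (_⊖_)
import Data.Integer.Properties as ℤ
open import Data.Rational using (1ℚ; _+_; _-_; 1/_)
import Data.Rational.Properties as ℚ
open import Data.Rational.Solver renaming (module +-*-Solver to ℚ-Solver)
open import Relation.Binary.PropositionalEquality using (_≢_; refl; sym; trans; cong; cong₂; module ≡-Reasoning)
open import Relation.Nullary using (yes; no)
open import Relation.Nullary.Decidable using (isYes≗does; dec-true; dec-false)
open import Relation.Nullary.Negation using (contradiction)
open import Relation.Nullary.Reflects using (ofʸ; ofⁿ)

sum-map-+ : ∀ {A : Set} (h k : A → ℕ) xs →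
            sumℕ (map (λ x → h x ℕ.+ k x) xs) ≡ sumℕ (map h xs) ℕ.+ sumℕ (map k xs)
sum-map-+ h k []       = refl
sum-map-+ h k (x ∷ xs) =
  trans (cong (h x ℕ.+ k x ℕ.+_) (sum-map-+ h k xs))
        (solve 4 (λ a b s t → (a :+ b) :+ (s :+ t) := (a :+ s) :+ (b :+ t)) refl
               (h x) (k x) (sumℕ (map h xs)) (sumℕ (map k xs)))
  where open ℕ-Solver

module _ {A : Set} where

  prodℚ-partition : ∀ (g : A → Bool) (f : A → ℚ) xs →
    prodℚ (map f (filter (λ x → g x ≟ᵇ true) xs)) * prodℚ (map f (filter (λ x → g x ≟ᵇ false) xs))
      ≡ prodℚ (map f xs)
  prodℚ-partition g f []       = ℚ.*-identityˡ 1ℚ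
  prodℚ-partition g f (x ∷ xs) with g x
  ... | true  = trans (ℚ.*-assoc (f x) _ _) (cong (f x *_) (prodℚ-partition g f xs))
  ... | false = trans (solve 3 (λ P F Q → P :* (F :* Q) := F :* (P :* Q)) refl
                             (prodℚ (map f (filter (λ x → g x ≟ᵇ true) xs))) (f x)
                             (prodℚ (map f (filter (λ x → g x ≟ᵇ false) xs))))
                      (cong (f x *_) (prodℚ-partition g f xs))
    where open ℚ-Solver

  All-≤-sum-map : ∀ (f : A → ℕ) xs → All (λ x → f x ℕ.≤ sumℕ (map f xs)) xs
  All-≤-sum-map f []       = []
  All-≤-sum-map f (x ∷ xs) =
    ℕ.m≤m+n (f x) _ ∷ All.map (λ le → ℕ.≤-trans le (ℕ.m≤n+m _ (f x))) (All-≤-sum-map f xs)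

  module _ (g : A → ℕ) where

    count : ℕ → List A → ℕ
    count i xs = length (filter (λ x → g x ℕ.≟ i) xs)

    count-[x]-≡ : ∀ x → count (g x) [ x ] ≡ 1
    count-[x]-≡ x = cong length (filter-accept (λ y → g y ℕ.≟ g x) refl)

    count-[x]-≢ : ∀ {x i} → g x ≢ i → count i [ x ] ≡ 0
    count-[x]-≢ {i = i} gx≢i = cong length (filter-reject (λ y → g y ℕ.≟ i) gx≢i)

    count-∷ : ∀ i x xs → count i (x ∷ xs) ≡ count i [ x ] ℕ.+ count i xs
    count-∷ i x xs = trans (cong length (filter-++ (λ y → g y ℕ.≟ i) [ x ] xs))
                           (length-++ (filter (λ y → g y ℕ.≟ i) [ x ]))

    module _ (f : ℕ → ℕ) where

      sum-count-[] : ∀ is → sumℕ (map (λ i → f i ℕ.* count i []) is) ≡ 0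
      sum-count-[] []       = refl
      sum-count-[] (i ∷ is) = cong₂ ℕ._+_ (ℕ.*-zeroʳ (f i)) (sum-count-[] is)

      sum-count-∉ : ∀ x is → g x ∉ is → sumℕ (map (λ i → f i ℕ.* count i [ x ]) is) ≡ 0
      sum-count-∉ x []       _   = refl
      sum-count-∉ x (i ∷ is) gx∉ =
        cong₂ ℕ._+_ (trans (cong (f i ℕ.*_) (count-[x]-≢ (gx∉ ∘ here))) (ℕ.*-zeroʳ (f i)))
                    (sum-count-∉ x is (gx∉ ∘ there))

      sum-count-∈ : ∀ x {is} → Unique is → g x ∈ is →
                    sumℕ (map (λ i → f i ℕ.* count i [ x ]) is) ≡ f (g x)
      sum-count-∈ x {_ ∷ is} (gx∉is ∷ _) (here refl) =
        trans (cong₂ ℕ._+_ (trans (cong (f (g x) ℕ.*_) (count-[x]-≡ x)) (ℕ.*-identityʳ (f (g x))))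
                           (sum-count-∉ x is (All¬⇒¬Any gx∉is)))
              (ℕ.+-identityʳ (f (g x)))
      sum-count-∈ x {i ∷ _} (i∉is ∷ u) (there gx∈is) =
        cong₂ ℕ._+_ (trans (cong (f i ℕ.*_) (count-[x]-≢ (All.lookup i∉is gx∈is ∘ sym)))
                           (ℕ.*-zeroʳ (f i)))
                    (sum-count-∈ x u gx∈is)

      sum-count : ∀ {is} → Unique is → ∀ xs → All (λ x → g x ∈ is) xs →
                  sumℕ (map (λ i → f i ℕ.* count i xs) is) ≡ sumℕ (map (f ∘ g) xs)
      sum-count {is} _ [] [] = sum-count-[] is
      sum-count {is} u (x ∷ xs) (gx∈is ∷ xs⊆is) = begin
        sumℕ (map (λ i → f i ℕ.* count i (x ∷ xs)) is)
          ≡⟨ cong sumℕ (map-cong (λ i → trans (cong (f i ℕ.*_) (count-∷ i x xs))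
                                             (ℕ.*-distribˡ-+ (f i) _ _)) is) ⟩
        sumℕ (map (λ i → f i ℕ.* count i [ x ] ℕ.+ f i ℕ.* count i xs) is)
          ≡⟨ sum-map-+ _ _ is ⟩
        sumℕ (map (λ i → f i ℕ.* count i [ x ]) is) ℕ.+ sumℕ (map (λ i → f i ℕ.* count i xs) is)
          ≡⟨ cong₂ ℕ._+_ (sum-count-∈ x u gx∈is) (sum-count u xs xs⊆is) ⟩
        f (g x) ℕ.+ sumℕ (map (f ∘ g) xs) ∎
        where open ≡-Reasoning

∈-suc-upTo : ∀ {k m} → 1 ℕ.≤ k → suc k ℕ.≤ m → k ∈ map suc (upTo (m ℕ.∸ 1))
∈-suc-upTo {suc _} {suc _} (s≤s z≤n) (s≤s k<m) = ∈-map⁺ suc (∈-upTo⁺ k<m)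

+m≡[1+m+k]-1-k : ∀ m k → + m ≡ (+ suc (m ℕ.+ k) -ℤ + 1) -ℤ + k
+m≡[1+m+k]-1-k m k = sym (begin
  (+ suc (m ℕ.+ k) -ℤ + 1) -ℤ + k ≡⟨ ℤ.[+m]-[+n]≡m⊖n (m ℕ.+ k) k ⟩
  (m ℕ.+ k) ⊖ k                    ≡⟨ ℤ.⊖-≥ (ℕ.m≤n+m k m) ⟩
  + (m ℕ.+ k ℕ.∸ k)                ≡⟨ cong +_ (ℕ.m+n∸n≡m m k) ⟩
  + m                              ∎)
  where open ≡-Reasoning

-- The probability that all edges of a list are present

module _ {n : ℕ} where

  ==E-refl : (e : Edge n) → (e ==E e) ≡ true
  ==E-refl e = trans (isYes≗does (e ≟E e)) (dec-true (e ≟E e) refl)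

  ==E-≢ : ∀ {e e′ : Edge n} → e ≢ e′ → (e ==E e′) ≡ false
  ==E-≢ {e} {e′} e≢e′ = trans (isYes≗does (e ≟E e′)) (dec-false (e ≟E e′) e≢e′)

  _∈ᵇ_ : Edge n → List (Edge n) → Bool
  e ∈ᵇ es = any (λ e′ → e ==E e′) es

  ∈ᵇ-∷-refl : ∀ e es → (e ∈ᵇ (e ∷ es)) ≡ true
  ∈ᵇ-∷-refl e es = cong (_∨ (e ∈ᵇ es)) (==E-refl e)

  ∈ᵇ-∷-≢ : ∀ {e x} es → x ≢ e → (e ∈ᵇ (x ∷ es)) ≡ (e ∈ᵇ es)
  ∈ᵇ-∷-≢ es x≢e = cong (_∨ _) (==E-≢ (x≢e ∘ sym))

  ∈⇒∈ᵇ : ∀ {e} {es : List (Edge n)} → e ∈ es → (e ∈ᵇ es) ≡ true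
  ∈⇒∈ᵇ {e} {_ ∷ es} (here refl)  = ∈ᵇ-∷-refl e es
  ∈⇒∈ᵇ {e} {x ∷ es} (there e∈es) = trans (cong ((e ==E x) ∨_) (∈⇒∈ᵇ e∈es)) (∨-zeroʳ _)

  ordered∈allEdges : ∀ {i j : Fin n} → toℕ i ℕ.≤ toℕ j → (i , j) ∈ allEdges n
  ordered∈allEdges {i} {j} i≤j =
    ∈-concatMap⁺ _ (lose (∈-allFin i) (∈-concatMap⁺ _ (lose (∈-allFin j) singleton)))
    where
    singleton : (i , j) ∈ (if toℕ i ≤ᵇ toℕ j then [ (i , j) ] else [])
    singleton with toℕ i ≤ᵇ toℕ j | ℕ.≤ᵇ-reflects-≤ (toℕ i) (toℕ j)
    ... | true  | _       = here refl
    ... | false | ofⁿ i≰j = contradiction i≤j i≰j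

  edge∈allEdges : ∀ (x y : Fin n) → edge x y ∈ allEdges n
  edge∈allEdges x y with toℕ x ≤ᵇ toℕ y | ℕ.≤ᵇ-reflects-≤ (toℕ x) (toℕ y)
  ... | true  | ofʸ x≤y = ordered∈allEdges x≤y
  ... | false | ofⁿ x≰y = ordered∈allEdges (ℕ.≰⇒≥ x≰y)

  steps⊆allEdges : ∀ (xs : List (Fin n)) → All (λ e → (e ∈ᵇ allEdges n) ≡ true) (steps xs)
  steps⊆allEdges (x ∷ y ∷ xs) = ∈⇒∈ᵇ (edge∈allEdges x y) ∷ steps⊆allEdges (y ∷ xs)
  steps⊆allEdges (_ ∷ [])     = []
  steps⊆allEdges []           = []

  remove : Edge n → List (Edge n) → List (Edge n)
  remove e []      = []
  remove e (x ∷ L) = if x ==E e then remove e L else x ∷ remove e L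

  remove-⊆ : ∀ {e} es L → All (λ x → (x ∈ᵇ (e ∷ es)) ≡ true) L →
             All (λ x → (x ∈ᵇ es) ≡ true) (remove e L)
  remove-⊆ es [] [] = []
  remove-⊆ {e} es (x ∷ L) (x∈ ∷ L⊆) with x ≟E e
  ... | yes refl = remove-⊆ es L L⊆
  ... | no _     = x∈ ∷ remove-⊆ es L L⊆

  ∉-⊆ : ∀ {e} es L → (e ∈ᵇ L) ≡ false → All (λ x → (x ∈ᵇ (e ∷ es)) ≡ true) L →
        All (λ x → (x ∈ᵇ es) ≡ true) L
  ∉-⊆ es [] _ [] = []
  ∉-⊆ {e} es (x ∷ L) e∉ (x∈ ∷ L⊆) with x ≟E e
  ... | yes refl = contradiction (trans (sym (∈ᵇ-∷-refl e L)) e∉) λ ()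
  ... | no x≢e   = x∈ ∷ ∉-⊆ es L (trans (sym (∈ᵇ-∷-≢ L x≢e)) e∉) L⊆

  all-set-true : ∀ e g L → all (set e true g) L ≡ all g (remove e L)
  all-set-true e g []      = refl
  all-set-true e g (x ∷ L) with x ==E e
  ... | true  = all-set-true e g L
  ... | false = cong (g x ∧_) (all-set-true e g L)

  all-set-false : ∀ e g L → (e ∈ᵇ L) ≡ true → all (set e false g) L ≡ false
  all-set-false e g (x ∷ L) e∈ with x ≟E e
  ... | yes refl = refl
  ... | no x≢e   = trans (cong (g x ∧_) (all-set-false e g L (trans (sym (∈ᵇ-∷-≢ L x≢e)) e∈)))
                         (∧-zeroʳ (g x))

  all-set-∉ : ∀ e b g L → (e ∈ᵇ L) ≡ false → all (set e b g) L ≡ all g L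
  all-set-∉ e b g []      _  = refl
  all-set-∉ e b g (x ∷ L) e∉ with x ≟E e
  ... | yes refl = contradiction (trans (sym (∈ᵇ-∷-refl e L)) e∉) λ ()
  ... | no x≢e   = cong (g x ∧_) (all-set-∉ e b g L (trans (sym (∈ᵇ-∷-≢ L x≢e)) e∉))

  module _ (p : Edge n → ℚ) where
    open ℚ-Solver

    expect-cong : ∀ es {f f′ : Graph n → ℚ} → (∀ g → f g ≡ f′ g) → expect p es f ≡ expect p es f′
    expect-cong []       f≗f′ = f≗f′ _
    expect-cong (e ∷ es) f≗f′ =
      cong₂ (λ t u → p e * t + (1ℚ - p e) * u)
            (expect-cong es (f≗f′ ∘ set e true)) (expect-cong es (f≗f′ ∘ set e false))

    expect-const : ∀ es q → expect p es (λ _ → q) ≡ q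
    expect-const []       q = refl
    expect-const (e ∷ es) q = trans (cong (λ t → p e * t + (1ℚ - p e) * t) (expect-const es q))
                                    (solve 2 (λ a t → a :* t :+ (con 1ℚ :- a) :* t := t) refl (p e) q)

    allPresent : List (Edge n) → Graph n → ℚ
    allPresent L g = if all g L then 1ℚ else 0ℚ

    expect-allPresent-∈ : ∀ {e} es L → (e ∈ᵇ L) ≡ true →
      expect p (e ∷ es) (allPresent L) ≡ p e * expect p es (allPresent (remove e L))
    expect-allPresent-∈ {e} es L e∈L = begin
      p e * expect p es (λ g → allPresent L (set e true g))
        + (1ℚ - p e) * expect p es (λ g → allPresent L (set e false g))
        ≡⟨ cong₂ (λ t u → p e * t + (1ℚ - p e) * u)
                 (expect-cong es (λ g → cong (λ b → if b then 1ℚ else 0ℚ) (all-set-true e g L)))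
                 (trans (expect-cong es (λ g → cong (λ b → if b then 1ℚ else 0ℚ) (all-set-false e g L e∈L)))
                        (expect-const es 0ℚ)) ⟩
      p e * expect p es (allPresent (remove e L)) + (1ℚ - p e) * 0ℚ
        ≡⟨ solve 2 (λ a t → a :* t :+ (con 1ℚ :- a) :* con 0ℚ := a :* t) refl (p e) _ ⟩
      p e * expect p es (allPresent (remove e L)) ∎
      where open ≡-Reasoning

    expect-allPresent-∉ : ∀ {e} es L → (e ∈ᵇ L) ≡ false →
      expect p (e ∷ es) (allPresent L) ≡ expect p es (allPresent L)
    expect-allPresent-∉ {e} es L e∉L =
      trans (cong₂ (λ t u → p e * t + (1ℚ - p e) * u)
                   (expect-cong es (λ g → cong (λ b → if b then 1ℚ else 0ℚ) (all-set-∉ e true g L e∉L)))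
                   (expect-cong es (λ g → cong (λ b → if b then 1ℚ else 0ℚ) (all-set-∉ e false g L e∉L))))
            (solve 2 (λ a t → a :* t :+ (con 1ℚ :- a) :* t := t) refl (p e) (expect p es (allPresent L)))

    newProduct : List (Edge n) → List (Edge n) → ℚ
    newProduct seen []      = 1ℚ
    newProduct seen (e ∷ L) =
      if e ∈ᵇ seen then newProduct (e ∷ seen) L else p e * newProduct (e ∷ seen) L

    newProduct-cong : ∀ {seen seen′} → (∀ e → (e ∈ᵇ seen) ≡ (e ∈ᵇ seen′)) →
                      ∀ L → newProduct seen L ≡ newProduct seen′ L
    newProduct-cong same []      = refl
    newProduct-cong same (e ∷ L) =
      cong₂ (λ b t → if b then t else p e * t) (same e)
            (newProduct-cong (λ x → cong ((x ==E e) ∨_) (same x)) L)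

    newProduct-dup : ∀ e seen L → newProduct (e ∷ e ∷ seen) L ≡ newProduct (e ∷ seen) L
    newProduct-dup e seen = newProduct-cong dup
      where
      dup : ∀ x → (x ∈ᵇ (e ∷ e ∷ seen)) ≡ (x ∈ᵇ (e ∷ seen))
      dup x with x ==E e
      ... | true  = refl
      ... | false = refl

    newProduct-swap : ∀ a b seen L → newProduct (a ∷ b ∷ seen) L ≡ newProduct (b ∷ a ∷ seen) L
    newProduct-swap a b seen = newProduct-cong swap
      where
      swap : ∀ x → (x ∈ᵇ (a ∷ b ∷ seen)) ≡ (x ∈ᵇ (b ∷ a ∷ seen))
      swap x with x ==E a | x ==E b
      ... | true  | true  = refl
      ... | true  | false = refl
      ... | false | _     = refl

    newProduct-remove : ∀ e seen L → newProduct (e ∷ seen) L ≡ newProduct seen (remove e L)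
    newProduct-remove e seen []      = refl
    newProduct-remove e seen (x ∷ L) with x ≟E e
    ... | yes refl = trans (newProduct-dup e seen L) (newProduct-remove e seen L)
    ... | no _     = cong (λ t → if x ∈ᵇ seen then t else p x * t)
                          (trans (newProduct-swap x e seen L) (newProduct-remove e (x ∷ seen) L))

    newProduct-pull : ∀ {e} seen L → (e ∈ᵇ seen) ≡ false → (e ∈ᵇ L) ≡ true →
                      newProduct seen L ≡ p e * newProduct (e ∷ seen) L
    newProduct-pull {e} seen (x ∷ L) e∉seen e∈L with x ≟E e
    ... | yes refl rewrite e∉seen = cong (p e *_) (sym (newProduct-dup e seen L))
    ... | no x≢e =
      trans (cong (λ t → if x ∈ᵇ seen then t else p x * t) pull) (pull-out-of-if (x ∈ᵇ seen))
      where
      Q = newProduct (x ∷ e ∷ seen) L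

      pull : newProduct (x ∷ seen) L ≡ p e * Q
      pull = trans (newProduct-pull (x ∷ seen) L (trans (∈ᵇ-∷-≢ seen x≢e) e∉seen)
                                                 (trans (sym (∈ᵇ-∷-≢ L x≢e)) e∈L))
                   (cong (p e *_) (newProduct-swap e x seen L))

      pull-out-of-if : ∀ b → (if b then p e * Q else p x * (p e * Q)) ≡ p e * (if b then Q else p x * Q)
      pull-out-of-if true  = refl
      pull-out-of-if false = solve 3 (λ a b t → a :* (b :* t) := b :* (a :* t)) refl (p x) (p e) Q

    expect-allPresent : ∀ es L → All (λ e → (e ∈ᵇ es) ≡ true) L →
                        expect p es (allPresent L) ≡ newProduct [] L
    expect-allPresent []       [] [] = refl
    expect-allPresent (e ∷ es) L L⊆ with e ∈ᵇ L in e∈L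
    ... | true = begin
      expect p (e ∷ es) (allPresent L)
        ≡⟨ expect-allPresent-∈ es L e∈L ⟩
      p e * expect p es (allPresent (remove e L))
        ≡⟨ cong (p e *_) (expect-allPresent es (remove e L) (remove-⊆ es L L⊆)) ⟩
      p e * newProduct [] (remove e L)
        ≡⟨ cong (p e *_) (newProduct-remove e [] L) ⟨
      p e * newProduct (e ∷ []) L
        ≡⟨ newProduct-pull [] L refl e∈L ⟨
      newProduct [] L ∎
      where open ≡-Reasoning
    ... | false = trans (expect-allPresent-∉ es L e∈L) (expect-allPresent es L (∉-⊆ es L e∈L L⊆))

  stepEdge : Step n → Edge n
  stepEdge s = edge (src s) (tgt s)

  newSteps : List (Step n) → List (Step n)
  newSteps = filterᵇ new

  newProduct-annGo : ∀ p ps seen x xs →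
    newProduct p seen (steps (x ∷ xs)) ≡ prodℚ (map (p ∘ stepEdge) (newSteps (annGo ps seen (x ∷ xs))))
  newProduct-annGo p ps seen x []       = refl
  newProduct-annGo p ps seen x (y ∷ xs) with edge x y ∈ᵇ seen
  ... | true  = newProduct-annGo p (x ∷ ps) (edge x y ∷ seen) y xs
  ... | false = cong (p (edge x y) *_) (newProduct-annGo p (x ∷ ps) (edge x y ∷ seen) y xs)

  Pr-PathExists : ∀ p (xs : List (Fin n)) →
                  Pr p (PathExists xs) ≡ prodℚ (map (p ∘ stepEdge) (newSteps (ann xs)))
  Pr-PathExists p []       = expect-allPresent p (allEdges n) [] []
  Pr-PathExists p (x ∷ xs) =
    trans (expect-allPresent p (allEdges n) (steps (x ∷ xs)) (steps⊆allEdges (x ∷ xs)))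
          (newProduct-annGo p [] [] x xs)

  clProb-edge : ∀ (d : Fin n → ℚ) .{{_ : NonZero (S d)}} x y → clProb d (edge x y) ≡ d x * d y * (1/ S d)
  clProb-edge d x y with toℕ x ≤ᵇ toℕ y
  ... | true  = refl
  ... | false = cong (_* (1/ S d)) (ℚ.*-comm (d y) (d x))

-- Walks cut into runs of new steps and repeating edge blocks

  data Walk : Fin n → Fin n → List (Step n) → Set where
    []  : ∀ {x} → Walk x x []
    _∷_ : ∀ {y ss} s → Walk (tgt s) y ss → Walk (src s) y (s ∷ ss)

  annGo-walk : ∀ {m} ps es (xs : Vec (Fin n) (suc m)) → Walk (head xs) (last xs) (annGo ps es (toList xs))
  annGo-walk ps es (x ∷ [])     = []
  annGo-walk ps es (x ∷ y ∷ xs) = _ ∷ annGo-walk (x ∷ ps) (edge x y ∷ es) (y ∷ xs)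

  length-annGo : ∀ {m} ps es (xs : Vec (Fin n) (suc m)) → length (annGo ps es (toList xs)) ≡ m
  length-annGo ps es (x ∷ [])     = refl
  length-annGo ps es (x ∷ y ∷ xs) = cong suc (length-annGo (x ∷ ps) (edge x y ∷ es) (y ∷ xs))

  EndsNew : List (Step n) → Set
  EndsNew ss = Maybe.map new (List.last ss) ≡ just true

  module _ (d : Fin n → ℚ) (c : ℚ) where
    open ℚ-Solver

    stepWeight : Step n → ℚ
    stepWeight s = d (src s) * d (tgt s) * c

    newWeight : List (Step n) → ℚ
    newWeight ss = prodℚ (map stepWeight (newSteps ss))

    interiorWeight : List (Step n) → ℚ
    interiorWeight ss = prodℚ (map (λ i → d i * d i * c) (interiorGo ss))

    blockWeight : List (Block n) → ℚ
    blockWeight bs = prodℚ (map (λ b → d (first b) * d (lst b) * c) bs)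

    -- Inside an open block b, the factor d (first b) left over by the last new step is carried
    -- along until the next new step supplies d (lst b) and c.
    mutual
      newWeight-fromNew : ∀ {x z y ps ss} →
        Walk x y (step x z true ps ∷ ss) → EndsNew (step x z true ps ∷ ss) →
        newWeight (step x z true ps ∷ ss)
          ≡ d x * d y * c * interiorWeight (step x z true ps ∷ ss) * blockWeight (blocksGo ss)
      newWeight-fromNew {x} {z} (_ ∷ []) _ = cong (_* 1ℚ) (sym (ℚ.*-identityʳ (d x * d z * c)))
      newWeight-fromNew {x} {z} {y} (_ ∷ w@(step _ _ true _ ∷ _)) e =
        trans (cong (d x * d z * c *_) (newWeight-fromNew w e))
              (solve 6 (λ X Z Y C I B → X :* Z :* C :* (Z :* Y :* C :* I :* B)
                                     := X :* Y :* C :* (Z :* Z :* C :* I) :* B)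
                     refl (d x) (d z) (d y) c _ _)
      newWeight-fromNew (_ ∷ (step _ _ false _ ∷ [])) ()
      newWeight-fromNew {x} {z} {y} {ss = _ ∷ ts} (_ ∷ (s@(step _ _ false _) ∷ w@(_ ∷ _))) e = begin
        d x * d z * c * newWeight ts
          ≡⟨ solve 4 (λ X Z C W → X :* Z :* C :* W := X :* C :* (Z :* W)) refl (d x) (d z) c _ ⟩
        d x * c * (d z * newWeight ts)
          ≡⟨ cong (d x * c *_) (newWeight-inBlock (startBlock s) w e) ⟩
        d x * c * (d y * I * B)
          ≡⟨ solve 5 (λ X C Y I B → X :* C :* (Y :* I :* B) := X :* Y :* C :* I :* B) refl (d x) c (d y) I B ⟩
        d x * d y * c * I * B ∎
        where
        open ≡-Reasoning
        I = interiorWeight ts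
        B = blockWeight (runGo (startBlock s) ts)

      newWeight-inBlock : ∀ b {y ss} → Walk (lst b) y ss → EndsNew ss →
        d (first b) * newWeight ss ≡ d y * interiorWeight ss * blockWeight (runGo b ss)
      newWeight-inBlock b [] ()
      newWeight-inBlock b {y} w@(step _ _ true _ ∷ _) e =
        trans (cong (d (first b) *_) (newWeight-fromNew w e))
              (solve 6 (λ F L Y C I B → F :* (L :* Y :* C :* I :* B) := Y :* I :* (F :* L :* C :* B))
                     refl (d (first b)) (d (lst b)) (d y) c _ _)
      newWeight-inBlock b (step _ _ false _ ∷ []) ()
      newWeight-inBlock b (s@(step _ _ false _) ∷ w@(_ ∷ _)) e = newWeight-inBlock (extendBlock b s) w e

  blockSpan : Block n → ℕ
  blockSpan b = suc (len b)

  totalSpan : List (Block n) → ℕ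
  totalSpan bs = sumℕ (map blockSpan bs)

  mutual
    length-fromNew : ∀ {x z ps} ss → EndsNew (step x z true ps ∷ ss) →
      length ss ≡ length (interiorGo (step x z true ps ∷ ss)) ℕ.+ totalSpan (blocksGo ss)
    length-fromNew []                                  _ = refl
    length-fromNew (step _ _ true _ ∷ ss)              e = cong suc (length-fromNew ss e)
    length-fromNew (step _ _ false _ ∷ [])             ()
    length-fromNew (s@(step _ _ false _) ∷ ss@(_ ∷ _)) e = length-inBlock (startBlock s) ss e

    length-inBlock : ∀ b ss → EndsNew ss →
      len b ℕ.+ length ss ≡ length (interiorGo ss) ℕ.+ totalSpan (runGo b ss)
    length-inBlock b []                                  ()
    length-inBlock b ss@(step _ _ true _ ∷ ts)           e =
      trans (cong (λ t → len b ℕ.+ suc t) (length-fromNew ts e))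
            (solve 3 (λ L I C → L :+ (con 1 :+ (I :+ C)) := I :+ ((con 1 :+ L) :+ C)) refl
                   (len b) (length (interiorGo ss)) (totalSpan (blocksGo ts)))
      where open ℕ-Solver
    length-inBlock b (step _ _ false _ ∷ [])             ()
    length-inBlock b (s@(step _ _ false _) ∷ ts@(_ ∷ _)) e =
      trans (ℕ.+-suc (len b) (length ts)) (length-inBlock (extendBlock b s) ts e)

  mutual
    blocksGo-nonempty : (ss : List (Step n)) → All (λ b → 1 ℕ.≤ len b) (blocksGo ss)
    blocksGo-nonempty []                          = []
    blocksGo-nonempty (step _ _ true _ ∷ ss)      = blocksGo-nonempty ss
    blocksGo-nonempty (s@(step _ _ false _) ∷ ss) = runGo-nonempty (startBlock s) ss (s≤s z≤n)

    runGo-nonempty : ∀ b ss → 1 ℕ.≤ len b → All (λ b → 1 ℕ.≤ len b) (runGo b ss)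
    runGo-nonempty b []                          1≤b = 1≤b ∷ []
    runGo-nonempty b (step _ _ true _ ∷ ss)      1≤b = 1≤b ∷ blocksGo-nonempty ss
    runGo-nonempty b (s@(step _ _ false _) ∷ ss) _   = runGo-nonempty (extendBlock b s) ss (s≤s z≤n)

R₁R₂-blockWeight : ∀ {n} (d : Fin n → ℚ) c xs →
  prodℚ (map (λ jk → d (proj₁ jk) * d (proj₂ jk) * c) (R₁ xs))
    * prodℚ (map (λ lm → d (proj₁ lm) * d (proj₂ lm) * c) (R₂ xs))
    ≡ blockWeight d c (blocks xs)
R₁R₂-blockWeight d c xs =
  trans (cong₂ _*_ (cong prodℚ (sym (map-∘ (filter (λ b → seenFirst b ≟ᵇ true) (blocks xs)))))
                   (cong prodℚ (sym (map-∘ (filter (λ b → seenFirst b ≟ᵇ false) (blocks xs))))))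
        (prodℚ-partition seenFirst (λ b → d (first b) * d (lst b) * c) (blocks xs))

Pr-PathExists≡clFormula : ∀ {n m} (d : Fin n → ℚ) .{{_ : NonZero (S d)}} (xs : Vec (Fin n) (suc m)) →
  LastNew (toList xs) → Pr (clProb d) (PathExists (toList xs)) ≡ clFormula d (head xs) (last xs) (toList xs)
Pr-PathExists≡clFormula d (x ∷ []) ()
Pr-PathExists≡clFormula d xs@(x ∷ _ ∷ _) lastNew = begin
  Pr (clProb d) (PathExists path)
    ≡⟨ Pr-PathExists (clProb d) path ⟩
  prodℚ (map (clProb d ∘ stepEdge) (newSteps (ann path)))
    ≡⟨ cong prodℚ (map-cong (λ s → clProb-edge d (src s) (tgt s)) (newSteps (ann path))) ⟩
  newWeight d c (ann path)
    ≡⟨ newWeight-fromNew d c (annGo-walk [] [] xs) lastNew ⟩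
  A * blockWeight d c (blocks path)
    ≡⟨ cong (A *_) (R₁R₂-blockWeight d c path) ⟨
  A * (R₁-weight * R₂-weight)
    ≡⟨ ℚ.*-assoc A R₁-weight R₂-weight ⟨
  clFormula d x (last xs) path ∎
  where
  open ≡-Reasoning
  c = 1/ S d
  path = toList xs
  A = d x * d (last xs) * c * interiorWeight d c (ann path)
  R₁-weight = prodℚ (map (λ jk → d (proj₁ jk) * d (proj₂ jk) * c) (R₁ path))
  R₂-weight = prodℚ (map (λ lm → d (proj₁ lm) * d (proj₂ lm) * c) (R₂ path))

length≡1+interior+totalSpan : ∀ {n m} (xs : Vec (Fin n) (suc m)) → LastNew (toList xs) →
  m ≡ suc (length (newInterior (toList xs)) ℕ.+ totalSpan (blocks (toList xs)))
length≡1+interior+totalSpan (x ∷ []) ()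
length≡1+interior+totalSpan (x ∷ y ∷ ys) lastNew =
  cong suc (trans (sym (length-annGo (x ∷ []) (edge x y ∷ []) (y ∷ ys)))
                  (length-fromNew (annGo (x ∷ []) (edge x y ∷ []) (toList (y ∷ ys))) lastNew))

blockSum≡totalSpan : ∀ {n} (xs : List (Fin n)) m → totalSpan (blocks xs) ℕ.≤ m →
  blockSum xs (suc m) ≡ totalSpan (blocks xs)
blockSum≡totalSpan xs m span≤m =
  sum-count len suc (Unique.map⁺ ℕ.suc-injective (Unique.upTo⁺ _)) (blocks xs)
    (All.zipWith (λ (1≤b , b<span) → ∈-suc-upTo 1≤b (ℕ.≤-trans b<span span≤m))
                 (blocksGo-nonempty (ann xs) , All-≤-sum-map blockSpan (blocks xs)))

-- LastNew alone forces r ≥ 1, the first step of a path is always new, and the identity holds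
-- for arbitrary weights d.
lemma4 : (n : ℕ) (d : Fin n → ℚ) .{{_ : NonZero (S d)}} →
    (∀ i → 0ℚ Data.Rational.≤ d i) →
    (∀ i → d i * d i Data.Rational.≤ S d) →
    (r : ℕ) → 1 Data.Nat.≤ r → (xs : Vec (Fin n) (suc r)) →
    FirstNew (toList xs) → LastNew (toList xs) →
    (Pr (clProb d) (PathExists (toList xs))
    ≡ clFormula d (head xs) (last xs) (toList xs))
    × (+ length (newInterior (toList xs))
    ≡ ((+ r -ℤ + 1) -ℤ + blockSum (toList xs) r))
lemma4 n d _ _ r _ xs _ lastNew = Pr-PathExists≡clFormula d xs lastNew , interiorSize
  where
  open ≡-Reasoning
  path = toList xs
  N = length (newInterior path)
  B = totalSpan (blocks path)

  interiorSize : + N ≡ (+ r -ℤ + 1) -ℤ + blockSum path r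
  interiorSize = begin
    + N
      ≡⟨ +m≡[1+m+k]-1-k N B ⟩
    (+ suc (N ℕ.+ B) -ℤ + 1) -ℤ + B
      ≡⟨ cong (λ k → (+ suc (N ℕ.+ B) -ℤ + 1) -ℤ + k)
              (blockSum≡totalSpan path (N ℕ.+ B) (ℕ.m≤n+m B N)) ⟨
    (+ suc (N ℕ.+ B) -ℤ + 1) -ℤ + blockSum path (suc (N ℕ.+ B))
      ≡⟨ cong (λ m → (+ m -ℤ + 1) -ℤ + blockSum path m) (length≡1+interior+totalSpan xs lastNew) ⟨
    (+ r -ℤ + 1) -ℤ + blockSum path r ∎
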